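{- Let $\sqsubset$ be a looping refinement and $\star$ a binary relation among schemata such that for all schemata $S_1,S_2$ with $S_1\star S_2$, $S_1$ has a model $I$ if and only if $S_2$ has a model $J$ with $\rho_I(n)=\rho_J(n)$ for every parameter $n$ (i.e. satisfiability of $S_1$ is equivalent to satisfiability of $S_2$, preserving the values of the parameters). Define $\sqsubset'$ by: $S_1\sqsubset' S_2$ iff there exist $S_1',S_2'$ with $S_1\star S_1'$, $S_2\star S_2'$ and $S_1'\sqsubset S_2'$. Then $\sqsubset'$ is a looping refinement.
   Context: Schemata are pairs $P\wedge\varphi_S$ of a pattern (built from literals indexed by linear integer expressions, $\top,\bot,\wedge,\vee$ and iterated connectives $\bigwedge_{i\mid\varphi}$, $\bigvee_{i\mid\varphi}$ over linear arithmetic constraints) and a linear arithmetic constraint $\varphi_S$; parameters are the free variables. An environment $\rho$ of $S$ is a ground substitution of the parameters with $\varphi_S\rho$ true; an interpretation $I$ consists of an environment $\rho_I$ and a propositional interpretation, and is a model of $S$ iff the propositional realization $[S]_{\rho_I}$ is true in it. For schemata $S_1,S_2$ with the same parameters $n_1,\dots,n_k$, $S_1$ loops on $S_2$ iff for every model $I$ of $S_1$ there is a model $J$ of $S_2$ with $\rho_J(n_j)<\rho_I(n_j)$ for some $j$ and $\rho_J(n_l)\le\rho_I(n_l)$ for $l\neq j$. A looping refinement is a binary relation between schemata contained in the looping relation. -}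

module Defs where

open import Data.Nat using (ℕ)
open import Data.Nat.Properties using (_≟_)
open import Data.Integer as ℤ using (ℤ)
open import Data.Bool using (Bool; true; false)
open import Data.List using (List; []; _∷_; _++_; filter; concatMap; map)
open import Data.List.Membership.Propositional using (_∈_)
open import Data.Product using (Σ; ∃; ∃-syntax; _×_; _,_)
open import Data.Sum using (_⊎_)
open import Data.Unit using (⊤)
open import Data.Empty using (⊥)
open import Relation.Nullary using (¬_; ¬?)
open import Relation.Binary.PropositionalEquality using (_≡_)

-- Integer variables (parameters and bound index variables) are named by ℕ.

Var : Set
Var = ℕ

data LExpr : Set where
  cst  : ℤ → LExpr
  var  : Var → LExpr
  _⊕_  : LExpr → LExpr → LExpr
  _⊛_  : ℤ → LExpr → LExpr

data Constr : Set where
  cTrue cFalse : Constr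
  _≤c_ _=c_    : LExpr → LExpr → Constr
  cNot         : Constr → Constr
  _∧c_ _∨c_    : Constr → Constr → Constr
  cEx cAll     : Var → Constr → Constr

data Pattern : Set where
  pos neg   : ℕ → List LExpr → Pattern
  pTop pBot : Pattern
  _∧p_ _∨p_ : Pattern → Pattern → Pattern
  bigAnd bigOr : Var → Constr → Pattern → Pattern

record Schema : Set where
  constructor _∧S_
  field
    pat  : Pattern
    cons : Constr
open Schema public

remove : Var → List Var → List Var
remove i = filter (λ y → ¬? (y ≟ i))

fvE : LExpr → List Var
fvE (cst _)   = []
fvE (var x)   = x ∷ []
fvE (e ⊕ f)   = fvE e ++ fvE f
fvE (_ ⊛ e)   = fvE e

fvC : Constr → List Var
fvC cTrue      = []
fvC cFalse     = []
fvC (e ≤c f)   = fvE e ++ fvE f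
fvC (e =c f)   = fvE e ++ fvE f
fvC (cNot φ)   = fvC φ
fvC (φ ∧c ψ)   = fvC φ ++ fvC ψ
fvC (φ ∨c ψ)   = fvC φ ++ fvC ψ
fvC (cEx i φ)  = remove i (fvC φ)
fvC (cAll i φ) = remove i (fvC φ)

fvP : Pattern → List Var
fvP (pos _ es) = concatMap fvE es
fvP (neg _ es) = concatMap fvE es
fvP pTop       = []
fvP pBot       = []
fvP (P ∧p Q)   = fvP P ++ fvP Q
fvP (P ∨p Q)   = fvP P ++ fvP Q
fvP (bigAnd i φ P) = remove i (fvC φ ++ fvP P)
fvP (bigOr i φ P)  = remove i (fvC φ ++ fvP P)

IsParam : Schema → Var → Set
IsParam S x = x ∈ (fvP (pat S) ++ fvC (cons S))

SameParams : Schema → Schema → Set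
SameParams S₁ S₂ = ∀ x → (IsParam S₁ x → IsParam S₂ x) × (IsParam S₂ x → IsParam S₁ x)

Env : Set
Env = Var → ℤ

_[_≔_] : Env → Var → ℤ → Env
(ρ [ i ≔ k ]) x with x ≟ i
... | Relation.Nullary.yes _ = k
... | Relation.Nullary.no _  = ρ x

evalE : Env → LExpr → ℤ
evalE ρ (cst k) = k
evalE ρ (var x) = ρ x
evalE ρ (e ⊕ f) = evalE ρ e ℤ.+ evalE ρ f
evalE ρ (k ⊛ e) = k ℤ.* evalE ρ e

⟦_⟧C : Constr → Env → Set
⟦ cTrue ⟧C ρ    = ⊤
⟦ cFalse ⟧C ρ   = ⊥
⟦ e ≤c f ⟧C ρ   = evalE ρ e ℤ.≤ evalE ρ f
⟦ e =c f ⟧C ρ   = evalE ρ e ≡ evalE ρ f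
⟦ cNot φ ⟧C ρ   = ¬ ⟦ φ ⟧C ρ
⟦ φ ∧c ψ ⟧C ρ   = ⟦ φ ⟧C ρ × ⟦ ψ ⟧C ρ
⟦ φ ∨c ψ ⟧C ρ   = ⟦ φ ⟧C ρ ⊎ ⟦ ψ ⟧C ρ
⟦ cEx i φ ⟧C ρ  = ∃[ k ] ⟦ φ ⟧C (ρ [ i ≔ k ])
⟦ cAll i φ ⟧C ρ = ∀ k → ⟦ φ ⟧C (ρ [ i ≔ k ])

PropInterp : Set
PropInterp = ℕ → List ℤ → Bool

⟦_⟧P : Pattern → Env → PropInterp → Set
⟦ pos p es ⟧P ρ v = v p (map (evalE ρ) es) ≡ true
⟦ neg p es ⟧P ρ v = v p (map (evalE ρ) es) ≡ false
⟦ pTop ⟧P ρ v     = ⊤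
⟦ pBot ⟧P ρ v     = ⊥
⟦ P ∧p Q ⟧P ρ v   = ⟦ P ⟧P ρ v × ⟦ Q ⟧P ρ v
⟦ P ∨p Q ⟧P ρ v   = ⟦ P ⟧P ρ v ⊎ ⟦ Q ⟧P ρ v
⟦ bigAnd i φ P ⟧P ρ v = ∀ k → ⟦ φ ⟧C (ρ [ i ≔ k ]) → ⟦ P ⟧P (ρ [ i ≔ k ]) v
⟦ bigOr i φ P ⟧P ρ v  = ∃[ k ] (⟦ φ ⟧C (ρ [ i ≔ k ]) × ⟦ P ⟧P (ρ [ i ≔ k ]) v)

record Interp : Set where
  constructor mkI
  field
    env  : Env
    prop : PropInterp
open Interp public

Model : Interp → Schema → Set
Model I S = ⟦ cons S ⟧C (env I) × ⟦ pat S ⟧P (env I) (prop I)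

SRel : Set₁
SRel = Schema → Schema → Set

Loops : SRel
Loops S₁ S₂ =
  SameParams S₁ S₂ ×
  (∀ I → Model I S₁ →
     ∃[ J ] (Model J S₂ ×
             (∃[ j ] (IsParam S₁ j × env J j ℤ.< env I j)) ×
             (∀ l → IsParam S₁ l → env J l ℤ.≤ env I l)))

LoopingRefinement : SRel → Set
LoopingRefinement R = ∀ S₁ S₂ → R S₁ S₂ → Loops S₁ S₂

SatPreserving : SRel → Set
SatPreserving R = ∀ S₁ S₂ → R S₁ S₂ →
  SameParams S₁ S₂ ×
  (∀ I → Model I S₁ → ∃[ J ] (Model J S₂ × (∀ n → IsParam S₁ n → env J n ≡ env I n))) ×
  (∀ J → Model J S₂ → ∃[ I ] (Model I S₁ × (∀ n → IsParam S₁ n → env I n ≡ env J n)))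

Conj : SRel → SRel → SRel
Conj ⋆ ⊏ S₁ S₂ = ∃[ S₁' ] ∃[ S₂' ] (⋆ S₁ S₁' × ⋆ S₂ S₂' × ⊏ S₁' S₂')

-- Both ⋆-steps preserve the parameters and move models back and forth
-- without changing the parameter values, so the strict decrease witnessed by
-- S₁' ⊏ S₂' is a decrease between a model of S₁ and a model of S₂.
module Submission where

open import Defs
open import Data.Integer using (_<_; _≤_)
open import Data.Product using (∃-syntax; _×_; _,_; proj₁; proj₂)
open import Function using (_∘_)
open import Relation.Binary.PropositionalEquality using (_≡_; sym; subst₂)

SameParams-sym : ∀ {S T} → SameParams S T → SameParams T S
SameParams-sym S~T x = proj₂ (S~T x) , proj₁ (S~T x)

SameParams-trans : ∀ {S T U} → SameParams S T → SameParams T U → SameParams S U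
SameParams-trans S~T T~U x =
  proj₁ (T~U x) ∘ proj₁ (S~T x) , proj₂ (S~T x) ∘ proj₂ (T~U x)

Agree : Schema → Interp → Interp → Set
Agree X I J = ∀ n → IsParam X n → env I n ≡ env J n

Lifts : Schema → Schema → Schema → Set
Lifts S T X = ∀ I → Model I S → ∃[ J ] (Model J T × Agree X J I)

Decreases : Schema → Interp → Interp → Set
Decreases X J I =
  (∃[ j ] (IsParam X j × env J j < env I j)) ×
  (∀ l → IsParam X l → env J l ≤ env I l)

Decreases-resp-SameParams : ∀ {X Y J I} → SameParams X Y → Decreases X J I → Decreases Y J I
Decreases-resp-SameParams X~Y ((j , j∈X , J<I) , J≤I) =
  (j , proj₁ (X~Y j) j∈X , J<I) , λ l → J≤I l ∘ proj₂ (X~Y l)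

Decreases-resp-Agree : ∀ {X J J' I I'} →
  Agree X J J' → Agree X I' I → Decreases X J' I' → Decreases X J I
Decreases-resp-Agree J≈J' I'≈I ((j , j∈X , J'<I') , J'≤I') =
  (j , j∈X , subst₂ _<_ (sym (J≈J' j j∈X)) (I'≈I j j∈X) J'<I') ,
  λ l l∈X → subst₂ _≤_ (sym (J≈J' l l∈X)) (I'≈I l l∈X) (J'≤I' l l∈X)

Loops-transport : ∀ {S₁ S₁' S₂ S₂'} →
  SameParams S₁ S₁' → Lifts S₁ S₁' S₁ →
  SameParams S₂ S₂' → Lifts S₂' S₂ S₂ →
  Loops S₁' S₂' → Loops S₁ S₂
Loops-transport {S₁} {S₁'} {S₂} {S₂'} S₁~S₁' lift₁ S₂~S₂' lift₂ (S₁'~S₂' , loop') =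
  S₁~S₂ , loop
  where
  S₁~S₂ : SameParams S₁ S₂
  S₁~S₂ = SameParams-trans {S₁} {S₁'} {S₂} S₁~S₁'
            (SameParams-trans {S₁'} {S₂'} {S₂} S₁'~S₂'
              (SameParams-sym {S₂} {S₂'} S₂~S₂'))

  Agree-S₁ : ∀ {J J'} → Agree S₂ J J' → Agree S₁ J J'
  Agree-S₁ J≈J' n = J≈J' n ∘ proj₁ (S₁~S₂ n)

  loop : ∀ I → Model I S₁ → ∃[ J ] (Model J S₂ × Decreases S₁ J I)
  loop I I⊨S₁ with lift₁ I I⊨S₁
  ... | I' , I'⊨S₁' , I'≈I with loop' I' I'⊨S₁'
  ... | J' , J'⊨S₂' , J'<I' with lift₂ J' J'⊨S₂'
  ... | J , J⊨S₂ , J≈J' =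
    J , J⊨S₂ ,
    Decreases-resp-Agree {S₁} {J} {J'} {I} {I'} (Agree-S₁ {J} {J'} J≈J') I'≈I
      (Decreases-resp-SameParams {S₁'} {S₁} {J'} {I'}
        (SameParams-sym {S₁} {S₁'} S₁~S₁') J'<I')

proposition9 : (⊏ ⋆ : SRel) → LoopingRefinement ⊏ → SatPreserving ⋆ →
    LoopingRefinement (Conj ⋆ ⊏)
proposition9 ⊏ ⋆ ⊏-loops ⋆-sat S₁ S₂ (S₁' , S₂' , S₁⋆S₁' , S₂⋆S₂' , S₁'⊏S₂')
  with ⋆-sat S₁ S₁' S₁⋆S₁' | ⋆-sat S₂ S₂' S₂⋆S₂'
... | S₁~S₁' , lift₁ , _ | S₂~S₂' , _ , lift₂ =
  Loops-transport S₁~S₁' lift₁ S₂~S₂' lift₂ (⊏-loops S₁' S₂' S₁'⊏S₂')
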